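{- The maps $\mathsf{MoToNe}$ and $\mathsf{NeToMo}$ defined in the context are mutually inverse: $\mathsf{MoToNe}\circ\mathsf{NeToMo}$ is the identity on neutral normal forms and $\mathsf{NeToMo}\circ\mathsf{MoToNe}$ is the identity on Motzkin trees.
   Context: Lambda terms in de Bruijn notation: $M ::= \underline{0} \mid S\,n \mid \lambda M \mid M\,M$ with indices $n ::= \underline{0}\mid S\,n$ (not necessarily closed). Normal forms $\mathcal{N}$ and neutral normal forms $\mathcal{M}$ are given by $\mathcal{N} ::= \mathcal{M} \mid \lambda\mathcal{N}$, $\mathcal{M} ::= \mathcal{M}\,\mathcal{N} \mid d$ with $d$ a de Bruijn index; every normal form is uniquely $\lambda^k P$ with $k\ge 0$ and $P$ neutral. A Motzkin tree is a finite rooted plane tree in which each node has $0$, $1$ (unary) or $2$ (binary, ordered left/right subtrees) children. Every Motzkin tree $T$ is of exactly one of the forms: (a) a unary path $u_n$: a chain of $n\ge1$ nodes, each unary except the last, which is a leaf; (b) a binary root with left subtree $t$ and right subtree $t'$; (c) a chain of $n\ge1$ unary nodes, the child of the last of which is a binary node with subtrees $t$ (left) and $t'$ (right). $\mathsf{MoToNe}$: in case (a) $\mathsf{MoToNe}(u_n) = S^{n-1}\underline{0}$; in case (b) $\mathsf{MoToNe}(T)=\mathsf{MoToNe}(t)\,\mathsf{MoToNe}(t')$; in case (c) $\mathsf{MoToNe}(T) = \mathsf{MoToNe}(t)\,(\lambda^n\,\mathsf{MoToNe}(t'))$. $\mathsf{NeToMo}$: $\mathsf{NeToMo}(S^{n-1}\underline{0})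 = u_n$; for a neutral $P$ and a neutral $P'$, $\mathsf{NeToMo}(P\,P')$ is the tree with binary root with left subtree $\mathsf{NeToMo}(P)$ and right subtree $\mathsf{NeToMo}(P')$; for neutral $P, P'$ and $n\ge1$, $\mathsf{NeToMo}(P\,(\lambda^n P'))$ is the chain of $n$ unary nodes followed by a binary node with left subtree $\mathsf{NeToMo}(P)$ and right subtree $\mathsf{NeToMo}(P')$. -}

module Defs where

open import Data.Nat using (ℕ; zero; suc)

data Index : Set where
  𝟘 : Index
  S : Index → Index

data Term : Set where
  var : Index → Term
  lam : Term → Term
  app : Term → Term → Term

mutual
  data Nf : Set where
    ne  : Ne → Nf
    lam : Nf → Nf

  data Ne : Set where
    var : Index → Ne
    app : Ne → Nf → Ne

mutual
  ⌜_⌝Nf : Nf → Term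
  ⌜ ne P ⌝Nf = ⌜ P ⌝Ne
  ⌜ lam N ⌝Nf = lam ⌜ N ⌝Nf

  ⌜_⌝Ne : Ne → Term
  ⌜ var d ⌝Ne = var d
  ⌜ app P N ⌝Ne = app ⌜ P ⌝Ne ⌜ N ⌝Nf

data Motzkin : Set where
  leaf   : Motzkin
  unary  : Motzkin → Motzkin
  binary : Motzkin → Motzkin → Motzkin

Sⁿ0 : ℕ → Index
Sⁿ0 zero = 𝟘
Sⁿ0 (suc k) = S (Sⁿ0 k)

lamⁿ : ℕ → Nf → Nf
lamⁿ zero N = N
lamⁿ (suc k) N = lam (lamⁿ k N)

-- u_n : chain of n ≥ 1 nodes (n-1 unary, then a leaf); u (suc k) = u_{k+1}
u : ℕ → Motzkin
u zero = leaf
u (suc k) = unary (u k)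

unaryⁿ : ℕ → Motzkin → Motzkin
unaryⁿ zero t = t
unaryⁿ (suc k) t = unary (unaryⁿ k t)

-- The auxiliary  go k t  computes MoToNe (unaryⁿ k t), i.e. it
-- walks down a unary chain, counting its length k.
--   (a) unaryⁿ k leaf = u_{k+1}          ↦ S^k 0
--   (b) binary t t'                      ↦ MoToNe t  MoToNe t'
--   (c) unaryⁿ (suc k) (binary t t')     ↦ MoToNe t (λ^{k+1} MoToNe t')
mutual
  MoToNe : Motzkin → Ne
  MoToNe t = go zero t

  go : ℕ → Motzkin → Ne
  go k leaf = var (Sⁿ0 k)
  go k (unary t) = go (suc k) t
  go zero (binary t t') = app (MoToNe t) (ne (MoToNe t'))
  go (suc k) (binary t t') = app (MoToNe t) (lamⁿ (suc k) (ne (MoToNe t')))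

-- NeToMo.
--   S^k 0              ↦ u_{k+1}
--   P P'   (P' neutral) ↦ binary (NeToMo P) (NeToMo P')
--   P (λ^n P')  (n ≥ 1) ↦ unaryⁿ n (binary (NeToMo P) (NeToMo P'))
indexToMo : Index → Motzkin
indexToMo 𝟘 = leaf
indexToMo (S d) = unary (indexToMo d)

mutual
  NeToMo : Ne → Motzkin
  NeToMo (var d) = indexToMo d
  NeToMo (app P N) = argToMo 0 (NeToMo P) N

  -- argToMo k t N  =  NeToMo (P (λ^k N)) where t = NeToMo P
  argToMo : ℕ → Motzkin → Nf → Motzkin
  argToMo k t (ne P') = unaryⁿ k (binary t (NeToMo P'))
  argToMo k t (lam N) = argToMo (suc k) t N

-- A chain of k unary nodes above a binary node corresponds exactly to a
-- λ-prefix of length k on an argument, and a unary chain ending in a leaf to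
-- an index S^k 0.  Both maps read such a chain off with an accumulator (go
-- and argToMo); once the accumulators are shown to commute with unaryⁿ and
-- lamⁿ, the two round trips are plain structural inductions.
module Submission where

open import Defs
open import Data.Nat using (ℕ; zero; suc; _+_)
open import Data.Nat.Properties using (+-suc; +-identityʳ)
open import Data.Product using (_×_; _,_)
open import Relation.Binary.PropositionalEquality
  using (_≡_; refl; cong; cong₂; trans; module ≡-Reasoning)

open ≡-Reasoning

toℕ : Index → ℕ
toℕ 𝟘 = zero
toℕ (S d) = suc (toℕ d)

Sⁿ0-toℕ : ∀ d → Sⁿ0 (toℕ d) ≡ d
Sⁿ0-toℕ 𝟘 = refl
Sⁿ0-toℕ (S d) = cong S (Sⁿ0-toℕ d)

indexToMo≡unaryⁿ-leaf : ∀ d → indexToMo d ≡ unaryⁿ (toℕ d) leaf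
indexToMo≡unaryⁿ-leaf 𝟘 = refl
indexToMo≡unaryⁿ-leaf (S d) = cong unary (indexToMo≡unaryⁿ-leaf d)

indexToMo-Sⁿ0 : ∀ k → indexToMo (Sⁿ0 k) ≡ unaryⁿ k leaf
indexToMo-Sⁿ0 zero = refl
indexToMo-Sⁿ0 (suc k) = cong unary (indexToMo-Sⁿ0 k)

unaryⁿ-suc : ∀ k t → unaryⁿ (suc k) t ≡ unaryⁿ k (unary t)
unaryⁿ-suc zero t = refl
unaryⁿ-suc (suc k) t = cong unary (unaryⁿ-suc k t)

lamⁿ-suc : ∀ k N → lamⁿ (suc k) N ≡ lamⁿ k (lam N)
lamⁿ-suc zero N = refl
lamⁿ-suc (suc k) N = cong lam (lamⁿ-suc k N)

go-unaryⁿ : ∀ j k t → go j (unaryⁿ k t) ≡ go (k + j) t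
go-unaryⁿ j zero t = refl
go-unaryⁿ j (suc k) t =
  trans (go-unaryⁿ (suc j) k t) (cong (λ m → go m t) (+-suc k j))

MoToNe-unaryⁿ : ∀ k t → MoToNe (unaryⁿ k t) ≡ go k t
MoToNe-unaryⁿ k t = trans (go-unaryⁿ 0 k t) (cong (λ m → go m t) (+-identityʳ k))

go-binary : ∀ k t t' → go k (binary t t') ≡ app (MoToNe t) (lamⁿ k (ne (MoToNe t')))
go-binary zero t t' = refl
go-binary (suc k) t t' = refl

MoToNe-unaryⁿ-binary : ∀ k t t' →
  MoToNe (unaryⁿ k (binary t t')) ≡ app (MoToNe t) (lamⁿ k (ne (MoToNe t')))
MoToNe-unaryⁿ-binary k t t' = trans (MoToNe-unaryⁿ k (binary t t')) (go-binary k t t')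

MoToNe-indexToMo : ∀ d → MoToNe (indexToMo d) ≡ var d
MoToNe-indexToMo d = begin
  MoToNe (indexToMo d)                 ≡⟨ cong MoToNe (indexToMo≡unaryⁿ-leaf d) ⟩
  MoToNe (unaryⁿ (toℕ d) leaf)         ≡⟨ MoToNe-unaryⁿ (toℕ d) leaf ⟩
  var (Sⁿ0 (toℕ d))                    ≡⟨ cong var (Sⁿ0-toℕ d) ⟩
  var d                                ∎

argToMo-lamⁿ : ∀ j k t N → argToMo j t (lamⁿ k N) ≡ argToMo (k + j) t N
argToMo-lamⁿ j zero t N = refl
argToMo-lamⁿ j (suc k) t N =
  trans (argToMo-lamⁿ (suc j) k t N) (cong (λ m → argToMo m t N) (+-suc k j))

NeToMo-app-lamⁿ : ∀ k P P' →
  NeToMo (app P (lamⁿ k (ne P'))) ≡ unaryⁿ k (binary (NeToMo P) (NeToMo P'))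
NeToMo-app-lamⁿ k P P' =
  trans (argToMo-lamⁿ 0 k (NeToMo P) (ne P'))
        (cong (λ m → unaryⁿ m (binary (NeToMo P) (NeToMo P'))) (+-identityʳ k))

mutual
  MoToNe∘NeToMo : ∀ P → MoToNe (NeToMo P) ≡ P
  MoToNe∘NeToMo (var d) = MoToNe-indexToMo d
  MoToNe∘NeToMo (app P N) =
    trans (MoToNe-argToMo 0 (NeToMo P) N) (cong (λ Q → app Q N) (MoToNe∘NeToMo P))

  MoToNe-argToMo : ∀ k t N → MoToNe (argToMo k t N) ≡ app (MoToNe t) (lamⁿ k N)
  MoToNe-argToMo k t (ne P') = begin
    MoToNe (unaryⁿ k (binary t (NeToMo P')))          ≡⟨ MoToNe-unaryⁿ-binary k t (NeToMo P') ⟩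
    app (MoToNe t) (lamⁿ k (ne (MoToNe (NeToMo P')))) ≡⟨ cong (λ Q → app (MoToNe t) (lamⁿ k (ne Q))) (MoToNe∘NeToMo P') ⟩
    app (MoToNe t) (lamⁿ k (ne P'))                   ∎
  MoToNe-argToMo k t (lam N) =
    trans (MoToNe-argToMo (suc k) t N) (cong (app (MoToNe t)) (lamⁿ-suc k N))

NeToMo-go : ∀ k T → NeToMo (go k T) ≡ unaryⁿ k T
NeToMo-go k leaf = indexToMo-Sⁿ0 k
NeToMo-go k (unary t) = trans (NeToMo-go (suc k) t) (unaryⁿ-suc k t)
NeToMo-go k (binary t t') = begin
  NeToMo (go k (binary t t'))                               ≡⟨ cong NeToMo (go-binary k t t') ⟩
  NeToMo (app (MoToNe t) (lamⁿ k (ne (MoToNe t'))))         ≡⟨ NeToMo-app-lamⁿ k (MoToNe t) (MoToNe t') ⟩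
  unaryⁿ k (binary (NeToMo (MoToNe t)) (NeToMo (MoToNe t'))) ≡⟨ cong (unaryⁿ k) (cong₂ binary (NeToMo-go 0 t) (NeToMo-go 0 t')) ⟩
  unaryⁿ k (binary t t')                                    ∎

proposition5 : ((P : Ne) → MoToNe (NeToMo P) ≡ P) × ((T : Motzkin) → NeToMo (MoToNe T) ≡ T)
proposition5 = MoToNe∘NeToMo , NeToMo-go 0
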